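{- For every integer $k \geq 1$ and $|q|<1$, \[ \sum_{n = 1}^\infty \frac{nq^{kn}}{(q; q)_n} = \frac{1}{(q^k; q)_\infty} \sum_{n = k}^\infty d_{\geq k} (n) q^n. \]
   Context: $d_{\geq k}(n)$ denotes the number of positive divisors of $n$ that are $\geq k$. Here $(q;q)_n=(1-q)\cdots(1-q^n)$ and $(a;q)_\infty=\prod_{j\ge0}(1-aq^j)$. -}

module Defs where

open import Data.Nat as ℕ using (ℕ; zero; suc; _∸_; _≤?_; _≟_)
open import Data.Nat.Divisibility using (_∣?_)
open import Data.Integer as ℤ using (ℤ; +_; -_; _+_; _*_; _-_)
open import Data.List using (List; map; filter; length; upTo)
open import Data.Bool using (if_then_else_)
open import Relation.Nullary.Decidable using (does; _×-dec_)

-- Formal power series in q with integer coefficients: N ↦ coefficient of q^N.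
FPS : Set
FPS = ℕ → ℤ

sumTo : ℕ → (ℕ → ℤ) → ℤ
sumTo zero    f = f 0
sumTo (suc N) f = sumTo N f + f (suc N)

sum1To : ℕ → (ℕ → ℤ) → ℤ
sum1To zero    f = + 0
sum1To (suc N) f = sum1To N f + f (suc N)

oneS : FPS
oneS N = if does (N ≟ 0) then + 1 else + 0

mono : ℕ → FPS
mono m N = if does (N ≟ m) then + 1 else + 0

_⊛_ : FPS → FPS → FPS
(a ⊛ b) N = sumTo N (λ i → a i * b (N ∸ i))
infixl 7 _⊛_

_⊝_ : FPS → FPS → FPS
(a ⊝ b) N = a N - b N

-- Reciprocal of a series with constant term 1 (standard recursion
-- b_0 = 1, b_{N+1} = - Σ_{i=0}^{N} a_{i+1} b_{N-i}); fuel argument is first.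
invAux : FPS → ℕ → ℕ → ℤ
invAux a _       zero    = + 1
invAux a zero    (suc N) = + 0
invAux a (suc f) (suc N) = - sumTo N (λ i → a (suc i) * invAux a f (N ∸ i))

inv : FPS → FPS
inv a N = invAux a N N

prodFrom : ℕ → ℕ → FPS
prodFrom s zero    = oneS ⊝ mono s
prodFrom s (suc m) = prodFrom s m ⊛ (oneS ⊝ mono (s ℕ.+ suc m))

qPoch : ℕ → FPS
qPoch zero    = oneS
qPoch (suc n) = prodFrom 1 n

-- (q^k;q)_∞ = Π_{j≥k} (1 - q^j), for k ≥ 1.  Its coefficient of q^N equals that
-- of the finite product Π_{j=k}^{k+N} (1 - q^j), since factors with j > N are ≡ 1 mod q^{N+1}.
qPochInf : ℕ → FPS
qPochInf k N = prodFrom k N N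

dGe : ℕ → ℕ → ℕ
dGe k n = length (filter (λ d → (k ≤? d) ×-dec (d ∣? n)) (map suc (upTo n)))

divSeries : ℕ → FPS
divSeries k N = if does (k ≤? N) then + dGe k N else + 0

-- LHS: Σ_{n≥1} n q^{kn} / (q;q)_n ; for k ≥ 1 only n ≤ N contribute to q^N.
lhsSeries : ℕ → FPS
lhsSeries k N = sum1To N (λ n → + n * (mono (k ℕ.* n) ⊛ inv (qPoch n)) N)

rhsSeries : ℕ → FPS
rhsSeries k = inv (qPochInf k) ⊛ divSeries k

{-# OPTIONS --safe #-}

-- Write eₖ = Σₙ q^{kn}/(q;q)ₙ, θeₖ = Σₙ n q^{kn}/(q;q)ₙ, Pₖ = (qᵏ;q)_∞ and Dₖ = Σₙ d_{≥k}(n) qⁿ.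
-- Since q^{k(n+1)} (1 - q^{n+1}) / (q;q)_{n+1} = qᵏ · q^{kn}/(q;q)ₙ, comparing eₖ with e_{k+1}
-- term by term gives (1 - qᵏ) eₖ = e_{k+1} and (1 - qᵏ) θeₖ = θe_{k+1} + qᵏ eₖ.  As
-- Pₖ = (1 - qᵏ) P_{k+1}, the product Pₖ eₖ does not depend on k; it is ≡ 1 mod qᵏ, hence
-- Pₖ eₖ = 1 (Euler), and then P_{k+1} eₖ = 1/(1 - qᵏ).  Consequently
-- Pₖ θeₖ = P_{k+1} θe_{k+1} + qᵏ/(1 - qᵏ).  The divisor series satisfies the same recursion
-- Dₖ = D_{k+1} + qᵏ/(1 - qᵏ), since d_{≥k}(n) - d_{≥k+1}(n) counts the divisor k of n.  So
-- Pₖ θeₖ - Dₖ does not depend on k and is ≡ 0 mod qᵏ, i.e. it vanishes.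

module Submission where

open import Defs
open import Data.Nat using (ℕ; _≤_)
open import Relation.Binary.PropositionalEquality using (_≡_)
open import Data.Nat as ℕ using (zero; suc; _<_; z≤n; s≤s; _∸_; _≤?_; NonZero)
import Data.Nat.Properties as ℕ
open import Data.Nat.Divisibility using (_∣?_; _∣_; _∣0; ∣m∸n∣n⇒∣m; ∣m+n∣m⇒∣n; ∣-refl; >⇒∤)
open import Data.Integer as ℤ using (ℤ; +_; -_; _+_; _*_; _-_)
import Data.Integer.Properties as ℤ
open import Data.Integer.Tactic.RingSolver using (solve-∀)
open import Data.Bool using (true; false; if_then_else_)
open import Data.List using ([_]; _++_; map; filter; length; upTo)
import Data.List.Properties as List
open import Data.Sum using (inj₁; inj₂)
open import Function.Bundles using (mk⇔)
open import Relation.Nullary using (Dec; yes; no; contradiction)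
open import Relation.Nullary.Decidable using (does; dec-true; dec-false; does-⇔; _×-dec_)
open import Relation.Unary using (Pred; Decidable)
open import Relation.Binary.PropositionalEquality
  using (refl; sym; trans; subst; cong; cong₂; _≗_; module ≡-Reasoning)
open ≡-Reasoning

-- Finite sums

sumTo-cong : ∀ N {f g : ℕ → ℤ} → (∀ i → i ≤ N → f i ≡ g i) → sumTo N f ≡ sumTo N g
sumTo-cong zero    f≡g = f≡g 0 z≤n
sumTo-cong (suc N) f≡g =
  cong₂ _+_ (sumTo-cong N (λ i i≤N → f≡g i (ℕ.m≤n⇒m≤1+n i≤N))) (f≡g (suc N) ℕ.≤-refl)

sumTo-zero : ∀ N {f : ℕ → ℤ} → (∀ i → i ≤ N → f i ≡ + 0) → sumTo N f ≡ + 0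
sumTo-zero zero    f≡0 = f≡0 0 z≤n
sumTo-zero (suc N) f≡0 =
  cong₂ _+_ (sumTo-zero N (λ i i≤N → f≡0 i (ℕ.m≤n⇒m≤1+n i≤N))) (f≡0 (suc N) ℕ.≤-refl)

sumTo-distrib-+ : ∀ N (f g : ℕ → ℤ) → sumTo N (λ i → f i + g i) ≡ sumTo N f + sumTo N g
sumTo-distrib-+ zero    f g = refl
sumTo-distrib-+ (suc N) f g =
  trans (cong (_+ (f (suc N) + g (suc N))) (sumTo-distrib-+ N f g))
        (interchange (sumTo N f) (sumTo N g) (f (suc N)) (g (suc N)))
  where
  interchange : ∀ a b c d → (a + b) + (c + d) ≡ (a + c) + (b + d)
  interchange = solve-∀

sumTo-distrib-- : ∀ N (f g : ℕ → ℤ) → sumTo N (λ i → f i - g i) ≡ sumTo N f - sumTo N g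
sumTo-distrib-- zero    f g = refl
sumTo-distrib-- (suc N) f g =
  trans (cong (_+ (f (suc N) - g (suc N))) (sumTo-distrib-- N f g))
        (interchange (sumTo N f) (sumTo N g) (f (suc N)) (g (suc N)))
  where
  interchange : ∀ a b c d → (a - b) + (c - d) ≡ (a + c) - (b + d)
  interchange = solve-∀

sumTo-*ˡ : ∀ N c (f : ℕ → ℤ) → sumTo N (λ i → c * f i) ≡ c * sumTo N f
sumTo-*ˡ zero    c f = refl
sumTo-*ˡ (suc N) c f =
  trans (cong (_+ (c * f (suc N))) (sumTo-*ˡ N c f)) (sym (ℤ.*-distribˡ-+ c _ _))

sumTo-sucˡ : ∀ N (f : ℕ → ℤ) → sumTo (suc N) f ≡ f 0 + sumTo N (λ i → f (suc i))
sumTo-sucˡ zero    f = refl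
sumTo-sucˡ (suc N) f =
  trans (cong (_+ f (suc (suc N))) (sumTo-sucˡ N f)) (ℤ.+-assoc (f 0) _ _)

sumTo-extend : ∀ {M N} (f : ℕ → ℤ) → N ≤ M → (∀ i → N < i → i ≤ M → f i ≡ + 0) →
               sumTo M f ≡ sumTo N f
sumTo-extend {zero}  f z≤n f≡0 = refl
sumTo-extend {suc M} {N} f N≤1+M f≡0 with ℕ.m≤n⇒m<n∨m≡n N≤1+M
... | inj₂ refl      = refl
... | inj₁ (s≤s N≤M) = begin
  sumTo M f + f (suc M) ≡⟨ cong₂ _+_ (sumTo-extend f N≤M (λ i N<i i≤M → f≡0 i N<i (ℕ.m≤n⇒m≤1+n i≤M)))
                                     (f≡0 (suc M) (s≤s N≤M) ℕ.≤-refl) ⟩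
  sumTo N f + + 0       ≡⟨ ℤ.+-identityʳ (sumTo N f) ⟩
  sumTo N f             ∎

sumTo-reverse : ∀ N (f : ℕ → ℤ) → sumTo N f ≡ sumTo N (λ i → f (N ∸ i))
sumTo-reverse zero    f = refl
sumTo-reverse (suc N) f = begin
  sumTo N f + f (suc N)                 ≡⟨ cong (_+ f (suc N)) (sumTo-reverse N f) ⟩
  sumTo N (λ i → f (N ∸ i)) + f (suc N) ≡⟨ ℤ.+-comm _ (f (suc N)) ⟩
  f (suc N) + sumTo N (λ i → f (N ∸ i)) ≡⟨ sym (sumTo-sucˡ N (λ i → f (suc N ∸ i))) ⟩
  sumTo (suc N) (λ i → f (suc N ∸ i))   ∎

sum1To≡sumTo : ∀ N (f : ℕ → ℤ) → f 0 ≡ + 0 → sum1To N f ≡ sumTo N f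
sum1To≡sumTo zero    f f0≡0 = sym f0≡0
sum1To≡sumTo (suc N) f f0≡0 = cong (_+ f (suc N)) (sum1To≡sumTo N f f0≡0)

-- Formal power series

zeroS : FPS
zeroS _ = + 0

infixl 6 _⊕_
_⊕_ : FPS → FPS → FPS
(a ⊕ b) N = a N + b N

infixr 8 _·_
_·_ : ℤ → FPS → FPS
(x · a) N = x * a N

1-q^_ : ℕ → FPS
1-q^ j = oneS ⊝ mono j

tail : FPS → FPS
tail a N = a (suc N)

infix 4 _≡_mod-q^_
_≡_mod-q^_ : FPS → FPS → ℕ → Set
a ≡ b mod-q^ m = ∀ i → i < m → a i ≡ b i

⊛-cong-mod : ∀ {m} a a′ b b′ → a ≡ a′ mod-q^ m → b ≡ b′ mod-q^ m → a ⊛ b ≡ a′ ⊛ b′ mod-q^ m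
⊛-cong-mod a a′ b b′ a≡a′ b≡b′ N N<m = sumTo-cong N λ i i≤N →
  cong₂ _*_ (a≡a′ i (ℕ.≤-<-trans i≤N N<m)) (b≡b′ (N ∸ i) (ℕ.≤-<-trans (ℕ.m∸n≤m N i) N<m))

⊛-congʳ-mod : ∀ {m} a b b′ → b ≡ b′ mod-q^ m → a ⊛ b ≡ a ⊛ b′ mod-q^ m
⊛-congʳ-mod a b b′ = ⊛-cong-mod a a b b′ (λ _ _ → refl)

⊛-cong : ∀ {a a′ b b′} → a ≗ a′ → b ≗ b′ → a ⊛ b ≗ a′ ⊛ b′
⊛-cong {a} {a′} {b} {b′} a≗a′ b≗b′ N =
  ⊛-cong-mod a a′ b b′ (λ i _ → a≗a′ i) (λ i _ → b≗b′ i) N (ℕ.n<1+n N)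

⊛-congˡ : ∀ {a a′} b → a ≗ a′ → a ⊛ b ≗ a′ ⊛ b
⊛-congˡ {a} {a′} b a≗a′ = ⊛-cong {a} {a′} {b} {b} a≗a′ (λ _ → refl)

⊛-congʳ : ∀ a {b b′} → b ≗ b′ → a ⊛ b ≗ a ⊛ b′
⊛-congʳ a {b} {b′} b≗b′ = ⊛-cong {a} {a} {b} {b′} (λ _ → refl) b≗b′

⊛-comm : ∀ a b → a ⊛ b ≗ b ⊛ a
⊛-comm a b N = begin
  sumTo N (λ i → a i * b (N ∸ i))             ≡⟨ sumTo-reverse N _ ⟩
  sumTo N (λ i → a (N ∸ i) * b (N ∸ (N ∸ i))) ≡⟨ sumTo-cong N (λ i i≤N →
     trans (cong (λ j → a (N ∸ i) * b j) (ℕ.m∸[m∸n]≡n i≤N)) (ℤ.*-comm (a (N ∸ i)) (b i))) ⟩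
  sumTo N (λ i → b i * a (N ∸ i))             ∎

⊛-suc : ∀ a b N → (a ⊛ b) (suc N) ≡ a 0 * b (suc N) + (tail a ⊛ b) N
⊛-suc a b N = sumTo-sucˡ N _

⊛-distribʳ-⊕ : ∀ a b c → (a ⊕ b) ⊛ c ≗ a ⊛ c ⊕ b ⊛ c
⊛-distribʳ-⊕ a b c N =
  trans (sumTo-cong N (λ i _ → ℤ.*-distribʳ-+ (c (N ∸ i)) (a i) (b i))) (sumTo-distrib-+ N _ _)

⊛-distribˡ-⊕ : ∀ a b c → a ⊛ (b ⊕ c) ≗ a ⊛ b ⊕ a ⊛ c
⊛-distribˡ-⊕ a b c N =
  trans (sumTo-cong N (λ i _ → ℤ.*-distribˡ-+ (a i) (b (N ∸ i)) (c (N ∸ i)))) (sumTo-distrib-+ N _ _)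

⊛-distribʳ-⊝ : ∀ a b c → (a ⊝ b) ⊛ c ≗ (a ⊛ c) ⊝ (b ⊛ c)
⊛-distribʳ-⊝ a b c N =
  trans (sumTo-cong N (λ i _ → distrib (a i) (b i) (c (N ∸ i)))) (sumTo-distrib-- N _ _)
  where
  distrib : ∀ x y z → (x - y) * z ≡ x * z - y * z
  distrib = solve-∀

⊛-distribˡ-⊝ : ∀ a b c → a ⊛ (b ⊝ c) ≗ (a ⊛ b) ⊝ (a ⊛ c)
⊛-distribˡ-⊝ a b c N =
  trans (sumTo-cong N (λ i _ → distrib (a i) (b (N ∸ i)) (c (N ∸ i)))) (sumTo-distrib-- N _ _)
  where
  distrib : ∀ x y z → x * (y - z) ≡ x * y - x * z
  distrib = solve-∀

·-⊛ : ∀ x a b → (x · a) ⊛ b ≗ x · (a ⊛ b)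
·-⊛ x a b N = trans (sumTo-cong N (λ i _ → ℤ.*-assoc x (a i) (b (N ∸ i)))) (sumTo-*ˡ N x _)

⊛-· : ∀ x a b → a ⊛ (x · b) ≗ x · (a ⊛ b)
⊛-· x a b N = trans (sumTo-cong N (λ i _ → leftComm x (a i) (b (N ∸ i)))) (sumTo-*ˡ N x _)
  where
  leftComm : ∀ x y z → y * (x * z) ≡ x * (y * z)
  leftComm = solve-∀

⊛-assoc : ∀ a b c → (a ⊛ b) ⊛ c ≗ a ⊛ (b ⊛ c)
⊛-assoc a b c zero    = ℤ.*-assoc (a 0) (b 0) (c 0)
⊛-assoc a b c (suc N) = begin
  ((a ⊛ b) ⊛ c) (suc N)
    ≡⟨ ⊛-suc (a ⊛ b) c N ⟩
  a 0 * b 0 * c (suc N) + (tail (a ⊛ b) ⊛ c) N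
    ≡⟨ cong (λ z → a 0 * b 0 * c (suc N) + z) (begin
         (tail (a ⊛ b) ⊛ c) N                        ≡⟨ ⊛-congˡ c (⊛-suc a b) N ⟩
         ((a 0 · tail b ⊕ tail a ⊛ b) ⊛ c) N         ≡⟨ ⊛-distribʳ-⊕ (a 0 · tail b) (tail a ⊛ b) c N ⟩
         ((a 0 · tail b) ⊛ c) N + ((tail a ⊛ b) ⊛ c) N
           ≡⟨ cong₂ _+_ (·-⊛ (a 0) (tail b) c N) (⊛-assoc (tail a) b c N) ⟩
         a 0 * (tail b ⊛ c) N + (tail a ⊛ (b ⊛ c)) N ∎) ⟩
  a 0 * b 0 * c (suc N) + (a 0 * (tail b ⊛ c) N + (tail a ⊛ (b ⊛ c)) N)
    ≡⟨ regroup (a 0) (b 0) (c (suc N)) _ _ ⟩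
  a 0 * (b 0 * c (suc N) + (tail b ⊛ c) N) + (tail a ⊛ (b ⊛ c)) N
    ≡⟨ cong (λ z → a 0 * z + (tail a ⊛ (b ⊛ c)) N) (sym (⊛-suc b c N)) ⟩
  a 0 * (b ⊛ c) (suc N) + (tail a ⊛ (b ⊛ c)) N
    ≡⟨ sym (⊛-suc a (b ⊛ c) N) ⟩
  (a ⊛ (b ⊛ c)) (suc N) ∎
  where
  regroup : ∀ x y z u v → x * y * z + (x * u + v) ≡ x * (y * z + u) + v
  regroup = solve-∀

⊛-leftComm : ∀ a b c → a ⊛ (b ⊛ c) ≗ b ⊛ (a ⊛ c)
⊛-leftComm a b c N = begin
  (a ⊛ (b ⊛ c)) N ≡⟨ sym (⊛-assoc a b c N) ⟩
  ((a ⊛ b) ⊛ c) N ≡⟨ ⊛-congˡ c (⊛-comm a b) N ⟩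
  ((b ⊛ a) ⊛ c) N ≡⟨ ⊛-assoc b a c N ⟩
  (b ⊛ (a ⊛ c)) N ∎

⊛-identityˡ : ∀ a → oneS ⊛ a ≗ a
⊛-identityˡ a zero    = ℤ.*-identityˡ (a 0)
⊛-identityˡ a (suc N) = begin
  (oneS ⊛ a) (suc N)                 ≡⟨ ⊛-suc oneS a N ⟩
  + 1 * a (suc N) + (tail oneS ⊛ a) N ≡⟨ cong₂ _+_ (ℤ.*-identityˡ (a (suc N)))
                                              (sumTo-zero N (λ i _ → ℤ.*-zeroˡ (a (N ∸ i)))) ⟩
  a (suc N) + + 0                    ≡⟨ ℤ.+-identityʳ (a (suc N)) ⟩
  a (suc N)                          ∎

⊛-identityʳ : ∀ a → a ⊛ oneS ≗ a
⊛-identityʳ a N = trans (⊛-comm a oneS N) (⊛-identityˡ a N)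

⊛-zeroʳ : ∀ a → a ⊛ zeroS ≗ zeroS
⊛-zeroʳ a N = sumTo-zero N (λ i _ → ℤ.*-zeroʳ (a i))

mono-⊛-suc : ∀ m a N → (mono (suc m) ⊛ a) (suc N) ≡ (mono m ⊛ a) N
mono-⊛-suc m a N = trans (⊛-suc (mono (suc m)) a N) (ℤ.+-identityˡ _)

mono-⊛-below : ∀ m a → mono m ⊛ a ≡ zeroS mod-q^ m
mono-⊛-below (suc m) a zero    _         = ℤ.*-zeroˡ (a 0)
mono-⊛-below (suc m) a (suc N) (s≤s N<m) = trans (mono-⊛-suc m a N) (mono-⊛-below m a N N<m)

mono-⊛-∸ : ∀ m a N → m ≤ N → (mono m ⊛ a) N ≡ a (N ∸ m)
mono-⊛-∸ zero    a N       _         = ⊛-identityˡ a N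
mono-⊛-∸ (suc m) a (suc N) (s≤s m≤N) = trans (mono-⊛-suc m a N) (mono-⊛-∸ m a N m≤N)

mono-⊛-mono : ∀ m n a → mono m ⊛ (mono n ⊛ a) ≗ mono (m ℕ.+ n) ⊛ a
mono-⊛-mono zero    n a N       = ⊛-identityˡ (mono n ⊛ a) N
mono-⊛-mono (suc m) n a zero    = trans (ℤ.*-zeroˡ ((mono n ⊛ a) 0)) (sym (ℤ.*-zeroˡ (a 0)))
mono-⊛-mono (suc m) n a (suc N) = begin
  (mono (suc m) ⊛ (mono n ⊛ a)) (suc N) ≡⟨ mono-⊛-suc m (mono n ⊛ a) N ⟩
  (mono m ⊛ (mono n ⊛ a)) N             ≡⟨ mono-⊛-mono m n a N ⟩
  (mono (m ℕ.+ n) ⊛ a) N                ≡⟨ sym (mono-⊛-suc (m ℕ.+ n) a N) ⟩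
  (mono (suc m ℕ.+ n) ⊛ a) (suc N)      ∎

1-q^-⊛ : ∀ j a → (1-q^ j) ⊛ a ≗ a ⊝ (mono j ⊛ a)
1-q^-⊛ j a N = trans (⊛-distribʳ-⊝ oneS (mono j) a N) (cong (_- (mono j ⊛ a) N) (⊛-identityˡ a N))

⊛-1-q^-≡ : ∀ j a → a ⊛ (1-q^ j) ≡ a mod-q^ j
⊛-1-q^-≡ j a N N<j = begin
  (a ⊛ (1-q^ j)) N              ≡⟨ ⊛-comm a (1-q^ j) N ⟩
  ((1-q^ j) ⊛ a) N              ≡⟨ 1-q^-⊛ j a N ⟩
  a N - (mono j ⊛ a) N          ≡⟨ cong (_-_ (a N)) (mono-⊛-below j a N N<j) ⟩
  a N - + 0                     ≡⟨ ℤ.+-identityʳ (a N) ⟩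
  a N                           ∎

1-q^-constant : ∀ j .{{_ : NonZero j}} → (1-q^ j) 0 ≡ + 1
1-q^-constant (suc _) = refl

invAux-fuel : ∀ a {f g} n → n ≤ f → n ≤ g → invAux a f n ≡ invAux a g n
invAux-fuel a zero    _         _         = refl
invAux-fuel a {suc f} {suc g} (suc n) (s≤s n≤f) (s≤s n≤g) = cong -_ (sumTo-cong n λ i _ →
  cong (a (suc i) *_)
       (invAux-fuel a (n ∸ i) (ℕ.≤-trans (ℕ.m∸n≤m n i) n≤f) (ℕ.≤-trans (ℕ.m∸n≤m n i) n≤g)))

inv-suc : ∀ a N → inv a (suc N) ≡ - (tail a ⊛ inv a) N
inv-suc a N = cong -_ (sumTo-cong N λ i _ →
  cong (a (suc i) *_) (invAux-fuel a (N ∸ i) (ℕ.m∸n≤m N i) ℕ.≤-refl))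

⊛-inverseʳ : ∀ a → a 0 ≡ + 1 → a ⊛ inv a ≗ oneS
⊛-inverseʳ a a0≡1 zero    = cong (_* + 1) a0≡1
⊛-inverseʳ a a0≡1 (suc N) = begin
  (a ⊛ inv a) (suc N)                      ≡⟨ ⊛-suc a (inv a) N ⟩
  a 0 * inv a (suc N) + (tail a ⊛ inv a) N ≡⟨ cong₂ (λ u v → u * v + (tail a ⊛ inv a) N) a0≡1 (inv-suc a N) ⟩
  + 1 * - x + x                            ≡⟨ cancel x ⟩
  + 0                                      ∎
  where
  x = (tail a ⊛ inv a) N
  cancel : ∀ x → + 1 * - x + x ≡ + 0
  cancel = solve-∀

⊛-inverseˡ : ∀ a → a 0 ≡ + 1 → inv a ⊛ a ≗ oneS
⊛-inverseˡ a a0≡1 N = trans (⊛-comm (inv a) a N) (⊛-inverseʳ a a0≡1 N)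

⊛≗⇒≗inv-⊛ : ∀ a x b → a 0 ≡ + 1 → a ⊛ x ≗ b → x ≗ inv a ⊛ b
⊛≗⇒≗inv-⊛ a x b a0≡1 ax≗b N = begin
  x N                   ≡⟨ sym (⊛-identityˡ x N) ⟩
  (oneS ⊛ x) N          ≡⟨ ⊛-congˡ x (λ i → sym (⊛-inverseˡ a a0≡1 i)) N ⟩
  ((inv a ⊛ a) ⊛ x) N   ≡⟨ ⊛-assoc (inv a) a x N ⟩
  (inv a ⊛ (a ⊛ x)) N   ≡⟨ ⊛-congʳ (inv a) ax≗b N ⟩
  (inv a ⊛ b) N         ∎

inv-unique : ∀ a x → a 0 ≡ + 1 → a ⊛ x ≗ oneS → x ≗ inv a
inv-unique a x a0≡1 ax≗1 N = trans (⊛≗⇒≗inv-⊛ a x oneS a0≡1 ax≗1 N) (⊛-identityʳ (inv a) N)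

-- q-Pochhammer products

prodFrom-≡1 : ∀ s m → prodFrom s m ≡ oneS mod-q^ s
prodFrom-≡1 s zero    i i<s = trans (sym (⊛-identityˡ (1-q^ s) i)) (⊛-1-q^-≡ s oneS i i<s)
prodFrom-≡1 s (suc m) i i<s =
  trans (⊛-1-q^-≡ (s ℕ.+ suc m) (prodFrom s m) i (ℕ.<-≤-trans i<s (ℕ.m≤m+n s (suc m))))
        (prodFrom-≡1 s m i i<s)

prodFrom-stable : ∀ s m N → N ≤ m → prodFrom s m N ≡ prodFrom s N N
prodFrom-stable s zero    zero z≤n = refl
prodFrom-stable s (suc m) N N≤1+m with ℕ.m≤n⇒m<n∨m≡n N≤1+m
... | inj₂ refl      = refl
... | inj₁ (s≤s N≤m) =
  trans (⊛-1-q^-≡ (s ℕ.+ suc m) (prodFrom s m) N (ℕ.<-≤-trans (s≤s N≤m) (ℕ.m≤n+m (suc m) s)))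
        (prodFrom-stable s m N N≤m)

prodFrom-split : ∀ s m → prodFrom s (suc m) ≗ (1-q^ s) ⊛ prodFrom (suc s) m
prodFrom-split s zero    N = cong (λ j → ((1-q^ s) ⊛ (1-q^ j)) N) (ℕ.+-comm s 1)
prodFrom-split s (suc m) N = begin
  (prodFrom s (suc m) ⊛ (1-q^ j)) N              ≡⟨ ⊛-congˡ (1-q^ j) (prodFrom-split s m) N ⟩
  (((1-q^ s) ⊛ prodFrom (suc s) m) ⊛ (1-q^ j)) N ≡⟨ ⊛-assoc (1-q^ s) (prodFrom (suc s) m) (1-q^ j) N ⟩
  ((1-q^ s) ⊛ (prodFrom (suc s) m ⊛ (1-q^ j))) N ≡⟨ cong (λ j → ((1-q^ s) ⊛ (prodFrom (suc s) m ⊛ (1-q^ j))) N)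
                                                        (ℕ.+-suc s (suc m)) ⟩
  ((1-q^ s) ⊛ prodFrom (suc s) (suc m)) N        ∎
  where
  j = s ℕ.+ suc (suc m)

qPochInf-≡1 : ∀ k → qPochInf k ≡ oneS mod-q^ k
qPochInf-≡1 k i = prodFrom-≡1 k i i

qPochInf-split : ∀ k → qPochInf k ≗ (1-q^ k) ⊛ qPochInf (suc k)
qPochInf-split k N = begin
  prodFrom k N N                          ≡⟨ prodFrom-stable k (suc N) N (ℕ.n≤1+n N) ⟨
  prodFrom k (suc N) N                    ≡⟨ prodFrom-split k N N ⟩
  ((1-q^ k) ⊛ prodFrom (suc k) N) N       ≡⟨ ⊛-congʳ-mod (1-q^ k) (prodFrom (suc k) N) (qPochInf (suc k))
                                               (λ j j≤N → prodFrom-stable (suc k) N j (ℕ.≤-pred j≤N)) N ℕ.≤-refl ⟩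
  ((1-q^ k) ⊛ qPochInf (suc k)) N         ∎

qPochInf-⊛-split : ∀ k a → qPochInf k ⊛ a ≗ qPochInf (suc k) ⊛ ((1-q^ k) ⊛ a)
qPochInf-⊛-split k a N = begin
  (qPochInf k ⊛ a) N                              ≡⟨ ⊛-congˡ a (qPochInf-split k) N ⟩
  (((1-q^ k) ⊛ qPochInf (suc k)) ⊛ a) N           ≡⟨ ⊛-assoc (1-q^ k) (qPochInf (suc k)) a N ⟩
  ((1-q^ k) ⊛ (qPochInf (suc k) ⊛ a)) N           ≡⟨ ⊛-leftComm (1-q^ k) (qPochInf (suc k)) a N ⟩
  (qPochInf (suc k) ⊛ ((1-q^ k) ⊛ a)) N           ∎

qPoch-suc : ∀ n → qPoch (suc n) ≗ qPoch n ⊛ (1-q^ suc n)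
qPoch-suc zero    N = sym (⊛-identityˡ (1-q^ 1) N)
qPoch-suc (suc n) N = refl

qPoch-constant : ∀ n → qPoch n 0 ≡ + 1
qPoch-constant zero    = refl
qPoch-constant (suc n) = prodFrom-≡1 1 n 0 (s≤s z≤n)

inv-qPoch-step : ∀ n → (1-q^ suc n) ⊛ inv (qPoch (suc n)) ≗ inv (qPoch n)
inv-qPoch-step n = inv-unique (qPoch n) ((1-q^ suc n) ⊛ inv (qPoch (suc n))) (qPoch-constant n) λ N → begin
  (qPoch n ⊛ ((1-q^ suc n) ⊛ inv (qPoch (suc n)))) N ≡⟨ ⊛-assoc (qPoch n) (1-q^ suc n) (inv (qPoch (suc n))) N ⟨
  ((qPoch n ⊛ (1-q^ suc n)) ⊛ inv (qPoch (suc n))) N ≡⟨ ⊛-congˡ (inv (qPoch (suc n))) (qPoch-suc n) N ⟨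
  (qPoch (suc n) ⊛ inv (qPoch (suc n))) N            ≡⟨ ⊛-inverseʳ (qPoch (suc n)) (qPoch-constant (suc n)) N ⟩
  oneS N                                             ∎

Summable : (ℕ → FPS) → Set
Summable f = ∀ n → f n ≡ zeroS mod-q^ n

-- Only the terms n ≤ N enter the coefficient of q^N, so ∑ f is the sum Σₙ f n only if f is Summable.
∑ : (ℕ → FPS) → FPS
∑ f N = sumTo N (λ n → f n N)

summable-· : ∀ (w : ℕ → ℤ) {f} → Summable f → Summable (λ n → w n · f n)
summable-· w f-summable n i i<n = trans (cong (w n *_) (f-summable n i i<n)) (ℤ.*-zeroʳ (w n))

summable-⊝ : ∀ {f g} → Summable f → Summable g → Summable (λ n → f n ⊝ g n)
summable-⊝ f-summable g-summable n i i<n = cong₂ _-_ (f-summable n i i<n) (g-summable n i i<n)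

∑-truncate : ∀ {f} → Summable f → ∀ {M N} → N ≤ M → sumTo M (λ n → f n N) ≡ ∑ f N
∑-truncate {f} f-summable N≤M = sumTo-extend _ N≤M (λ n N<n _ → f-summable n _ N<n)

∑-unshift : ∀ {f} → Summable f → f 0 ≗ zeroS → ∑ f ≗ ∑ (λ n → f (suc n))
∑-unshift {f} f-summable f0≗0 N = begin
  ∑ f N                                   ≡⟨ ∑-truncate f-summable (ℕ.n≤1+n N) ⟨
  sumTo (suc N) (λ n → f n N)             ≡⟨ sumTo-sucˡ N (λ n → f n N) ⟩
  f 0 N + sumTo N (λ n → f (suc n) N)     ≡⟨ cong (_+ sumTo N (λ n → f (suc n) N)) (f0≗0 N) ⟩
  + 0 + sumTo N (λ n → f (suc n) N)       ≡⟨ ℤ.+-identityˡ _ ⟩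
  ∑ (λ n → f (suc n)) N                   ∎

⊛-sumTo : ∀ M a (g : ℕ → FPS) →
          a ⊛ (λ i → sumTo M (λ m → g m i)) ≗ (λ N → sumTo M (λ m → (a ⊛ g m) N))
⊛-sumTo zero    a g N = refl
⊛-sumTo (suc M) a g N =
  trans (⊛-distribˡ-⊕ a (λ i → sumTo M (λ m → g m i)) (g (suc M)) N)
        (cong (_+ (a ⊛ g (suc M)) N) (⊛-sumTo M a g N))

⊛-∑ : ∀ {f} → Summable f → ∀ a → a ⊛ ∑ f ≗ ∑ (λ n → a ⊛ f n)
⊛-∑ {f} f-summable a N = begin
  (a ⊛ ∑ f) N                              ≡⟨ ⊛-congʳ-mod a (λ i → sumTo N (λ n → f n i)) (∑ f)
                                                (λ i i≤N → ∑-truncate f-summable (ℕ.≤-pred i≤N)) N ℕ.≤-refl ⟨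
  (a ⊛ (λ i → sumTo N (λ n → f n i))) N    ≡⟨ ⊛-sumTo N a f N ⟩
  ∑ (λ n → a ⊛ f n) N                      ∎

-- The series Σₙ w(n) q^{kn} / (q;q)ₙ

term : ℕ → ℕ → FPS
term k n = mono (k ℕ.* n) ⊛ inv (qPoch n)

term-zero : ∀ k → term k 0 ≗ oneS
term-zero k N = begin
  (mono (k ℕ.* 0) ⊛ inv oneS) N ≡⟨ cong (λ j → (mono j ⊛ inv oneS) N) (ℕ.*-zeroʳ k) ⟩
  (oneS ⊛ inv oneS) N           ≡⟨ ⊛-inverseʳ oneS refl N ⟩
  oneS N                        ∎

term-summable : ∀ k .{{_ : NonZero k}} → Summable (term k)
term-summable k n i i<n = mono-⊛-below (k ℕ.* n) (inv (qPoch n)) i (ℕ.<-≤-trans i<n (ℕ.m≤n*m n k))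

term-step : ∀ k n → (term k (suc n) ⊝ term (suc k) (suc n)) ≗ mono k ⊛ term k n
term-step k n N = begin
  (mono a ⊛ B) N - (mono (suc n ℕ.+ a) ⊛ B) N     ≡⟨ cong (λ j → (mono a ⊛ B) N - (mono j ⊛ B) N) (ℕ.+-comm (suc n) a) ⟩
  (mono a ⊛ B) N - (mono (a ℕ.+ suc n) ⊛ B) N     ≡⟨ cong (_-_ ((mono a ⊛ B) N)) (mono-⊛-mono a (suc n) B N) ⟨
  (mono a ⊛ B) N - (mono a ⊛ (mono (suc n) ⊛ B)) N ≡⟨ ⊛-distribˡ-⊝ (mono a) B (mono (suc n) ⊛ B) N ⟨
  (mono a ⊛ (B ⊝ (mono (suc n) ⊛ B))) N           ≡⟨ ⊛-congʳ (mono a) (λ i → sym (1-q^-⊛ (suc n) B i)) N ⟩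
  (mono a ⊛ ((1-q^ suc n) ⊛ B)) N                 ≡⟨ ⊛-congʳ (mono a) (inv-qPoch-step n) N ⟩
  (mono a ⊛ inv (qPoch n)) N                      ≡⟨ cong (λ j → (mono j ⊛ inv (qPoch n)) N) (ℕ.*-suc k n) ⟩
  (mono (k ℕ.+ k ℕ.* n) ⊛ inv (qPoch n)) N        ≡⟨ mono-⊛-mono k (k ℕ.* n) (inv (qPoch n)) N ⟨
  (mono k ⊛ term k n) N                           ∎
  where
  a = k ℕ.* suc n
  B = inv (qPoch (suc n))

weighted : (ℕ → ℤ) → ℕ → FPS
weighted w k = ∑ (λ n → w n · term k n)

weighted-≡ : ∀ w k → weighted w k ≡ w 0 · oneS mod-q^ k
weighted-≡ w k N N<k = begin
  sumTo N (λ n → w n * term k n N) ≡⟨ sumTo-extend _ z≤n higher-terms-vanish ⟩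
  w 0 * term k 0 N                 ≡⟨ cong (w 0 *_) (term-zero k N) ⟩
  w 0 * oneS N                     ∎
  where
  higher-terms-vanish : ∀ n → 0 < n → n ≤ N → w n * term k n N ≡ + 0
  higher-terms-vanish n@(suc _) _ _ =
    trans (cong (w n *_) (mono-⊛-below (k ℕ.* n) (inv (qPoch n)) N (ℕ.<-≤-trans N<k (ℕ.m≤m*n k n))))
          (ℤ.*-zeroʳ (w n))

weighted-⊕ : ∀ u v k → weighted (λ n → u n + v n) k ≗ weighted u k ⊕ weighted v k
weighted-⊕ u v k N =
  trans (sumTo-cong N (λ n _ → ℤ.*-distribʳ-+ (term k n N) (u n) (v n))) (sumTo-distrib-+ N _ _)

weighted-step : ∀ w k .{{_ : NonZero k}} →
                (weighted w k ⊝ weighted w (suc k)) ≗ mono k ⊛ weighted (λ n → w (suc n)) k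
weighted-step w k N = begin
  weighted w k N - weighted w (suc k) N          ≡⟨ sumTo-distrib-- N _ _ ⟨
  sumTo N (λ n → w n * term k n N - w n * term (suc k) n N)
                                                 ≡⟨ sumTo-cong N (λ n _ → distrib (w n) (term k n N) _) ⟨
  ∑ difference N                                 ≡⟨ ∑-unshift difference-summable difference-zero N ⟩
  ∑ (λ n → difference (suc n)) N                 ≡⟨ sumTo-cong N (λ n _ → shifted-difference n) ⟩
  ∑ (λ n → mono k ⊛ (w (suc n) · term k n)) N    ≡⟨ ⊛-∑ (summable-· (λ n → w (suc n)) (term-summable k)) (mono k) N ⟨
  (mono k ⊛ weighted (λ n → w (suc n)) k) N      ∎
  where
  distrib : ∀ x y z → x * (y - z) ≡ x * y - x * z
  distrib = solve-∀
  difference : ℕ → FPS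
  difference n = w n · (term k n ⊝ term (suc k) n)
  difference-summable : Summable difference
  difference-summable = summable-· w (summable-⊝ (term-summable k) (term-summable (suc k)))
  difference-zero : difference 0 ≗ zeroS
  difference-zero i = trans (cong (w 0 *_) (ℤ.+-inverseʳ (term k 0 i))) (ℤ.*-zeroʳ (w 0))
  shifted-difference : ∀ n → w (suc n) * (term k (suc n) N - term (suc k) (suc n) N)
                           ≡ (mono k ⊛ (w (suc n) · term k n)) N
  shifted-difference n =
    trans (cong (w (suc n) *_) (term-step k n N)) (sym (⊛-· (w (suc n)) (mono k) (term k n) N))

-- The q-exponential Σₙ zⁿ/(q;q)ₙ at z = qᵏ, and its image under z d/dz.
qExp : ℕ → FPS
qExp = weighted (λ _ → + 1)

θqExp : ℕ → FPS
θqExp = weighted (λ n → + n)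

qExp-≡1 : ∀ k → qExp k ≡ oneS mod-q^ k
qExp-≡1 k i i<k = trans (weighted-≡ (λ _ → + 1) k i i<k) (ℤ.*-identityˡ (oneS i))

θqExp-≡0 : ∀ k → θqExp k ≡ zeroS mod-q^ k
θqExp-≡0 k i i<k = trans (weighted-≡ (λ n → + n) k i i<k) (ℤ.*-zeroˡ (oneS i))

qExp-step : ∀ k .{{_ : NonZero k}} → (1-q^ k) ⊛ qExp k ≗ qExp (suc k)
qExp-step k N = begin
  ((1-q^ k) ⊛ qExp k) N                    ≡⟨ 1-q^-⊛ k (qExp k) N ⟩
  qExp k N - (mono k ⊛ qExp k) N           ≡⟨ cong (_-_ (qExp k N)) (weighted-step (λ _ → + 1) k N) ⟨
  qExp k N - (qExp k N - qExp (suc k) N)   ≡⟨ cancel (qExp k N) (qExp (suc k) N) ⟩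
  qExp (suc k) N                           ∎
  where
  cancel : ∀ x y → x - (x - y) ≡ y
  cancel = solve-∀

θqExp-step : ∀ k .{{_ : NonZero k}} → (1-q^ k) ⊛ θqExp k ≗ θqExp (suc k) ⊕ mono k ⊛ qExp k
θqExp-step k N = begin
  ((1-q^ k) ⊛ θqExp k) N                 ≡⟨ 1-q^-⊛ k (θqExp k) N ⟩
  θqExp k N - (mono k ⊛ θqExp k) N       ≡⟨ rearrange (θqExp k N) (θqExp (suc k) N) _ _ difference ⟩
  θqExp (suc k) N + (mono k ⊛ qExp k) N  ∎
  where
  rearrange : ∀ x y u v → x - y ≡ v + u → x - u ≡ y + v
  rearrange x y u v x-y≡v+u = begin
    x - u               ≡⟨ expand x y u ⟩
    (x - y) + y - u     ≡⟨ cong (λ z → z + y - u) x-y≡v+u ⟩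
    (v + u) + y - u     ≡⟨ collapse u v y ⟩
    y + v               ∎
    where
    expand : ∀ x y u → x - u ≡ (x - y) + y - u
    expand = solve-∀
    collapse : ∀ u v y → (v + u) + y - u ≡ y + v
    collapse = solve-∀
  difference : θqExp k N - θqExp (suc k) N ≡ (mono k ⊛ qExp k) N + (mono k ⊛ θqExp k) N
  difference = begin
    θqExp k N - θqExp (suc k) N                            ≡⟨ weighted-step +_ k N ⟩
    (mono k ⊛ weighted (λ n → + 1 + + n) k) N              ≡⟨ ⊛-congʳ (mono k) (weighted-⊕ (λ _ → + 1) (λ n → + n) k) N ⟩
    (mono k ⊛ (qExp k ⊕ θqExp k)) N                        ≡⟨ ⊛-distribˡ-⊕ (mono k) (qExp k) (θqExp k) N ⟩
    (mono k ⊛ qExp k) N + (mono k ⊛ θqExp k) N             ∎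

-- Euler's identity

-- The N-th coefficient of a k ⊝ b k equals that of a K ⊝ b K for K > N, where a K and b K agree.
stationary-≡mod⇒≗ : (a b : ℕ → FPS) →
                    (∀ k .{{_ : NonZero k}} → (a k ⊝ b k) ≗ (a (suc k) ⊝ b (suc k))) →
                    (∀ k → a k ≡ b k mod-q^ k) →
                    ∀ k .{{_ : NonZero k}} → a k ≗ b k
stationary-≡mod⇒≗ a b invariant a≡b (suc k) N = ℤ.i-j≡0⇒i≡j (a (suc k) N) (b (suc k) N) (begin
  a (suc k) N - b (suc k) N ≡⟨ iterate N N ⟩
  a K N - b K N             ≡⟨ cong (_- b K N) (a≡b K N (s≤s (ℕ.m≤m+n N k))) ⟩
  b K N - b K N             ≡⟨ ℤ.+-inverseʳ (b K N) ⟩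
  + 0                       ∎)
  where
  K = suc (N ℕ.+ k)
  iterate : ∀ d → (a (suc k) ⊝ b (suc k)) ≗ (a (suc (d ℕ.+ k)) ⊝ b (suc (d ℕ.+ k)))
  iterate zero    i = refl
  iterate (suc d) i = trans (iterate d i) (invariant (suc (d ℕ.+ k)) i)

qPochInf-⊛-qExp : ∀ k .{{_ : NonZero k}} → qPochInf k ⊛ qExp k ≗ oneS
qPochInf-⊛-qExp = stationary-≡mod⇒≗ (λ k → qPochInf k ⊛ qExp k) (λ _ → oneS) invariant agree
  where
  invariant : ∀ k .{{_ : NonZero k}} →
              ((qPochInf k ⊛ qExp k) ⊝ oneS) ≗ ((qPochInf (suc k) ⊛ qExp (suc k)) ⊝ oneS)
  invariant k N = cong (_- oneS N)
    (trans (qPochInf-⊛-split k (qExp k) N) (⊛-congʳ (qPochInf (suc k)) (qExp-step k) N))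
  agree : ∀ k → qPochInf k ⊛ qExp k ≡ oneS mod-q^ k
  agree k i i<k = trans (⊛-cong-mod (qPochInf k) oneS (qExp k) oneS (qPochInf-≡1 k) (qExp-≡1 k) i i<k)
                        (⊛-identityˡ oneS i)

iverson : ∀ {a} {A : Set a} → Dec A → ℕ
iverson a? = if does a? then 1 else 0

geom : ℕ → FPS
geom k N = + iverson (k ∣? N)

geom-∸ : ∀ k N → k ≤ N → geom k (N ∸ k) ≡ geom k N
geom-∸ k N k≤N = cong (λ b → + (if b then 1 else 0)) (does-⇔ (mk⇔ to from) (k ∣? (N ∸ k)) (k ∣? N))
  where
  to : k ∣ N ∸ k → k ∣ N
  to k∣N∸k = ∣m∸n∣n⇒∣m k k≤N k∣N∸k ∣-refl
  from : k ∣ N → k ∣ N ∸ k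
  from k∣N = ∣m+n∣m⇒∣n (subst (k ∣_) (sym (ℕ.m+[n∸m]≡n k≤N)) k∣N) ∣-refl

mono-⊛-geom : ∀ k N → k ≤ N → (mono k ⊛ geom k) N ≡ geom k N
mono-⊛-geom k N k≤N = trans (mono-⊛-∸ k (geom k) N k≤N) (geom-∸ k N k≤N)

1-q^-⊛-geom : ∀ k .{{_ : NonZero k}} → (1-q^ k) ⊛ geom k ≗ oneS
1-q^-⊛-geom k@(suc _) N = trans (1-q^-⊛ k (geom k) N) (split (k ≤? N))
  where
  split : Dec (k ≤ N) → geom k N - (mono k ⊛ geom k) N ≡ oneS N
  split (yes k≤N) = trans (cong (_-_ (geom k N)) (mono-⊛-geom k N k≤N))
                          (trans (ℤ.+-inverseʳ (geom k N)) (above N k≤N))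
    where
    above : ∀ N → k ≤ N → + 0 ≡ oneS N
    above (suc _) _  = refl
  split (no k≰N) = trans (cong (_-_ (geom k N)) (mono-⊛-below k (geom k) N (ℕ.≰⇒> k≰N)))
                         (trans (ℤ.+-identityʳ (geom k N)) (below N (ℕ.≰⇒> k≰N)))
    where
    below : ∀ N → N < k → geom k N ≡ oneS N
    below zero    _   = cong (λ b → + (if b then 1 else 0)) (dec-true (k ∣? 0) (k ∣0))
    below (suc N) N<k = cong (λ b → + (if b then 1 else 0)) (dec-false (k ∣? suc N) (>⇒∤ N<k))

qPochInf-suc-⊛-qExp : ∀ k .{{_ : NonZero k}} → qPochInf (suc k) ⊛ qExp k ≗ geom k
qPochInf-suc-⊛-qExp k N =
  trans (inv-unique (1-q^ k) (qPochInf (suc k) ⊛ qExp k) (1-q^-constant k) inverse N)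
        (sym (inv-unique (1-q^ k) (geom k) (1-q^-constant k) (1-q^-⊛-geom k) N))
  where
  inverse : (1-q^ k) ⊛ (qPochInf (suc k) ⊛ qExp k) ≗ oneS
  inverse i = begin
    ((1-q^ k) ⊛ (qPochInf (suc k) ⊛ qExp k)) i ≡⟨ ⊛-leftComm (1-q^ k) (qPochInf (suc k)) (qExp k) i ⟩
    (qPochInf (suc k) ⊛ ((1-q^ k) ⊛ qExp k)) i ≡⟨ qPochInf-⊛-split k (qExp k) i ⟨
    (qPochInf k ⊛ qExp k) i                    ≡⟨ qPochInf-⊛-qExp k i ⟩
    oneS i                                     ∎

-- The divisor series

countTo : ∀ {ℓ} {P : Pred ℕ ℓ} → Decidable P → ℕ → ℕ
countTo P? n = length (filter P? (map suc (upTo n)))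

countTo-suc : ∀ {ℓ} {P : Pred ℕ ℓ} (P? : Decidable P) n →
              countTo P? (suc n) ≡ countTo P? n ℕ.+ iverson (P? (suc n))
countTo-suc P? n = begin
  length (filter P? (map suc (upTo (suc n))))
    ≡⟨ cong (λ xs → length (filter P? (map suc xs))) (List.upTo-∷ʳ n) ⟨
  length (filter P? (map suc (upTo n ++ [ n ])))
    ≡⟨ cong (λ xs → length (filter P? xs)) (List.map-++ suc (upTo n) [ n ]) ⟩
  length (filter P? (map suc (upTo n) ++ [ suc n ]))
    ≡⟨ cong length (List.filter-++ P? (map suc (upTo n)) [ suc n ]) ⟩
  length (filter P? (map suc (upTo n)) ++ filter P? [ suc n ])
    ≡⟨ List.length-++ (filter P? (map suc (upTo n))) ⟩
  countTo P? n ℕ.+ length (filter P? [ suc n ])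
    ≡⟨ cong (countTo P? n ℕ.+_) (singleton (suc n)) ⟩
  countTo P? n ℕ.+ iverson (P? (suc n)) ∎
  where
  singleton : ∀ x → length (filter P? [ x ]) ≡ iverson (P? x)
  singleton x with does (P? x)
  ... | true  = refl
  ... | false = refl

module _ {ℓ} {Q : Pred ℕ ℓ} (Q? : Decidable Q) where

  iverson-≥-below : ∀ {k} d → d < k → iverson ((k ≤? d) ×-dec Q? d) ≡ 0
  iverson-≥-below {k} d d<k = by-cases (k ≤? d)
    where
    by-cases : (k≤?d : Dec (k ≤ d)) → iverson (k≤?d ×-dec Q? d) ≡ 0
    by-cases (yes k≤d) = contradiction k≤d (ℕ.<⇒≱ d<k)
    by-cases (no  _)   = refl

  countTo-≥-below : ∀ {k} n → n < k → countTo (λ d → (k ≤? d) ×-dec Q? d) n ≡ 0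
  countTo-≥-below zero    _   = refl
  countTo-≥-below (suc n) n<k = trans (countTo-suc _ n)
    (cong₂ ℕ._+_ (countTo-≥-below n (ℕ.<-trans (ℕ.n<1+n n) n<k)) (iverson-≥-below (suc n) n<k))

  -- The candidate n + 1 counts towards both k and k + 1, unless n + 1 = k.
  boundary-shift : ∀ k n → iverson ((k ≤? n) ×-dec Q? k) ℕ.+ iverson ((k ≤? suc n) ×-dec Q? (suc n))
                         ≡ iverson ((suc k ≤? suc n) ×-dec Q? (suc n)) ℕ.+ iverson ((k ≤? suc n) ×-dec Q? k)
  boundary-shift k n = by-cases (k ≤? n) (k ≤? suc n) (suc k ≤? suc n)
    where
    by-cases : (k≤?n : Dec (k ≤ n)) (k≤?1+n : Dec (k ≤ suc n)) (k<?1+n : Dec (suc k ≤ suc n)) →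
               iverson (k≤?n ×-dec Q? k) ℕ.+ iverson (k≤?1+n ×-dec Q? (suc n))
                 ≡ iverson (k<?1+n ×-dec Q? (suc n)) ℕ.+ iverson (k≤?1+n ×-dec Q? k)
    by-cases (yes _)   (yes _)     (yes _)   = ℕ.+-comm (iverson (Q? k)) (iverson (Q? (suc n)))
    by-cases (yes k≤n) (no  k≰1+n) _         = contradiction (ℕ.m≤n⇒m≤1+n k≤n) k≰1+n
    by-cases (yes k≤n) (yes _)     (no  k≮n) = contradiction (s≤s k≤n) k≮n
    by-cases (no  k≰n) _           (yes k<n) = contradiction (ℕ.≤-pred k<n) k≰n
    by-cases (no  _)   (no  _)     (no  _)   = refl
    by-cases (no  k≰n) (yes k≤1+n) (no  _)   =
      cong (λ d → iverson (Q? d)) (sym (ℕ.≤-antisym k≤1+n (ℕ.≰⇒> k≰n)))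

  countTo-≥-step : ∀ k .{{_ : NonZero k}} n →
                   countTo (λ d → (k ≤? d) ×-dec Q? d) n
                     ≡ countTo (λ d → (suc k ≤? d) ×-dec Q? d) n ℕ.+ iverson ((k ≤? n) ×-dec Q? k)
  countTo-≥-step (suc _) zero    = refl
  countTo-≥-step k       (suc n) = begin
    C k (suc n)                                ≡⟨ countTo-suc _ n ⟩
    C k n ℕ.+ new k                            ≡⟨ cong (ℕ._+ new k) (countTo-≥-step k n) ⟩
    C (suc k) n ℕ.+ old n ℕ.+ new k            ≡⟨ ℕ.+-assoc (C (suc k) n) (old n) (new k) ⟩
    C (suc k) n ℕ.+ (old n ℕ.+ new k)          ≡⟨ cong (C (suc k) n ℕ.+_) (boundary-shift k n) ⟩
    C (suc k) n ℕ.+ (new (suc k) ℕ.+ old (suc n)) ≡⟨ ℕ.+-assoc (C (suc k) n) (new (suc k)) (old (suc n)) ⟨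
    C (suc k) n ℕ.+ new (suc k) ℕ.+ old (suc n) ≡⟨ cong (ℕ._+ old (suc n)) (countTo-suc _ n) ⟨
    C (suc k) (suc n) ℕ.+ old (suc n)          ∎
    where
    C : ℕ → ℕ → ℕ
    C j = countTo (λ d → (j ≤? d) ×-dec Q? d)
    new : ℕ → ℕ
    new j = iverson ((j ≤? suc n) ×-dec Q? (suc n))
    old : ℕ → ℕ
    old m = iverson ((k ≤? m) ×-dec Q? k)

dGe-step : ∀ k .{{_ : NonZero k}} N → dGe k N ≡ dGe (suc k) N ℕ.+ iverson ((k ≤? N) ×-dec (k ∣? N))
dGe-step k N = countTo-≥-step (_∣? N) k N

divSeries≡dGe : ∀ k N → divSeries k N ≡ + dGe k N
divSeries≡dGe k N = by-cases (k ≤? N)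
  where
  by-cases : (k≤?N : Dec (k ≤ N)) → (if does k≤?N then + dGe k N else + 0) ≡ + dGe k N
  by-cases (yes _)  = refl
  by-cases (no k≰N) = cong +_ (sym (countTo-≥-below (_∣? N) N (ℕ.≰⇒> k≰N)))

divSeries-≡0 : ∀ k → divSeries k ≡ zeroS mod-q^ k
divSeries-≡0 k i i<k = cong (λ b → if b then + dGe k i else + 0) (dec-false (k ≤? i) (ℕ.<⇒≱ i<k))

divSeries-step : ∀ k .{{_ : NonZero k}} → (divSeries k ⊝ divSeries (suc k)) ≗ mono k ⊛ geom k
divSeries-step k N = begin
  divSeries k N - divSeries (suc k) N       ≡⟨ cong₂ _-_ (divSeries≡dGe k N) (divSeries≡dGe (suc k) N) ⟩
  + dGe k N - + dGe (suc k) N               ≡⟨ cong (λ m → + m - + dGe (suc k) N) (dGe-step k N) ⟩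
  + dGe (suc k) N + + e - + dGe (suc k) N   ≡⟨ cancel (+ dGe (suc k) N) (+ e) ⟩
  + e                                       ≡⟨ by-cases (k ≤? N) ⟩
  (mono k ⊛ geom k) N                       ∎
  where
  e = iverson ((k ≤? N) ×-dec (k ∣? N))
  cancel : ∀ x y → x + y - x ≡ y
  cancel = solve-∀
  by-cases : (k≤?N : Dec (k ≤ N)) → + iverson (k≤?N ×-dec (k ∣? N)) ≡ (mono k ⊛ geom k) N
  by-cases (yes k≤N) = sym (mono-⊛-geom k N k≤N)
  by-cases (no k≰N)  = sym (mono-⊛-below k (geom k) N (ℕ.≰⇒> k≰N))

qPochInf-⊛-θqExp : ∀ k .{{_ : NonZero k}} → qPochInf k ⊛ θqExp k ≗ divSeries k
qPochInf-⊛-θqExp = stationary-≡mod⇒≗ (λ k → qPochInf k ⊛ θqExp k) divSeries invariant agree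
  where
  invariant : ∀ k .{{_ : NonZero k}} →
              ((qPochInf k ⊛ θqExp k) ⊝ divSeries k)
                ≗ ((qPochInf (suc k) ⊛ θqExp (suc k)) ⊝ divSeries (suc k))
  invariant k N = begin
    (qPochInf k ⊛ θqExp k) N - divSeries k N
      ≡⟨ cong (_- divSeries k N) (begin
           (qPochInf k ⊛ θqExp k) N                           ≡⟨ qPochInf-⊛-split k (θqExp k) N ⟩
           (P′ ⊛ ((1-q^ k) ⊛ θqExp k)) N                      ≡⟨ ⊛-congʳ P′ (θqExp-step k) N ⟩
           (P′ ⊛ (θqExp (suc k) ⊕ mono k ⊛ qExp k)) N         ≡⟨ ⊛-distribˡ-⊕ P′ (θqExp (suc k)) (mono k ⊛ qExp k) N ⟩
           x + (P′ ⊛ (mono k ⊛ qExp k)) N                     ≡⟨ cong (λ z → x + z) (⊛-leftComm P′ (mono k) (qExp k) N) ⟩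
           x + (mono k ⊛ (P′ ⊛ qExp k)) N                     ≡⟨ cong (λ z → x + z)
                                                                     (⊛-congʳ (mono k) (qPochInf-suc-⊛-qExp k) N) ⟩
           x + (mono k ⊛ geom k) N                            ≡⟨ cong (λ z → x + z) (divSeries-step k N) ⟨
           x + (divSeries k N - divSeries (suc k) N)          ∎) ⟩
    x + (divSeries k N - divSeries (suc k) N) - divSeries k N ≡⟨ cancel x (divSeries k N) (divSeries (suc k) N) ⟩
    x - divSeries (suc k) N                                   ∎
    where
    P′ = qPochInf (suc k)
    x = (P′ ⊛ θqExp (suc k)) N
    cancel : ∀ x y z → x + (y - z) - y ≡ x - z
    cancel = solve-∀
  agree : ∀ k → qPochInf k ⊛ θqExp k ≡ divSeries k mod-q^ k
  agree k i i<k = begin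
    (qPochInf k ⊛ θqExp k) i ≡⟨ ⊛-congʳ-mod (qPochInf k) (θqExp k) zeroS (θqExp-≡0 k) i i<k ⟩
    (qPochInf k ⊛ zeroS) i   ≡⟨ ⊛-zeroʳ (qPochInf k) i ⟩
    + 0                      ≡⟨ divSeries-≡0 k i i<k ⟨
    divSeries k i            ∎

lhsSeries≗θqExp : ∀ k → lhsSeries k ≗ θqExp k
lhsSeries≗θqExp k N = sum1To≡sumTo N (λ n → + n * term k n N) (ℤ.*-zeroˡ (term k 0 N))

lemma2p2 : (k : ℕ) → 1 ≤ k → (N : ℕ) → lhsSeries k N ≡ rhsSeries k N
lemma2p2 k@(suc _) _ N = begin
  lhsSeries k N ≡⟨ lhsSeries≗θqExp k N ⟩
  θqExp k N     ≡⟨ ⊛≗⇒≗inv-⊛ (qPochInf k) (θqExp k) (divSeries k)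
                               (qPochInf-≡1 k 0 (s≤s z≤n)) (qPochInf-⊛-θqExp k) N ⟩
  rhsSeries k N ∎
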